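{- Let $Q_8=\langle \sigma,\tau \mid \sigma^{4}=e,\ \tau^2=\sigma^{2},\ \tau^{ -1}\sigma\tau=\sigma^{ -1}\rangle$ and $S=\{\sigma,\sigma^{ -1},\tau,\tau^{ -1}\}$. Every edge of the Cayley graph $\Gamma(Q_8,S)$ has Ricci curvature $\kappa=\frac12$.
   Context: Let $G=(V,E)$ be a finite connected simple undirected graph with graph distance $d$, $N(x)$ the set of neighbors of $x$, and $\deg(x)=|N(x)|$. For $\alpha\in[0,1]$ and $x\in V$ define the probability measure $\mu_x^\alpha$ on $V$ by $\mu_x^\alpha(x)=\alpha$, $\mu_x^\alpha(v)=\frac{1-\alpha}{\deg(x)}$ for $v\in N(x)$, and $\mu_x^\alpha(v)=0$ otherwise. For probability measures $\mu,\nu$ on $V$, the 1-Wasserstein distance is $W_1(\mu,\nu)=\inf_\pi\sum_{x,y\in V}d(x,y)\pi(x,y)$, the infimum over all $\pi:V\times V\to[0,1]$ with $\sum_y\pi(x,y)=\mu(x)$ and $\sum_x\pi(x,y)=\nu(y)$. For $x\neq y$, $\kappa_\alpha(x,y)=1-\frac{W_1(\mu_x^\alpha,\mu_y^\alpha)}{d(x,y)}$, and the Ricci curvature (of Lin–Lu–Yau) is $\kappa(x,y)=\lim_{\alpha\to1}\frac{\kappa_\alpha(x,y)}{1-\alpha}$. For a group $\mathcal G$ and a generating set $S$ with $e\notin S$ and $S=S^{ -1}$, the Cayley graph $\Gamma(\mathcal G,S)$ is the simple undirected graph with vertex set $\mathcal G$ and edge set $\{\{g,gs\}: g\in\mathcal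 G,\ s\in S\}$.
   Formalization: The limit as α → 1 defining κ is taken only along rational α, and W₁ is taken over transport plans π with rational values. -}

module Defs where

open import Data.Bool using (Bool; true; false; _∧_; _∨_; if_then_else_; T)
open import Data.Nat as ℕ using (ℕ; zero; suc)
open import Data.Nat.DivMod using (_mod_)
open import Data.Fin as Fin using (Fin; toℕ)
open import Data.Fin.Properties using () renaming (_≟_ to _≟F_)
open import Data.List using (List; []; _∷_; map; foldr; concatMap; length; filter)
open import Data.Bool.ListAction using (any)
open import Data.Product using (_×_; _,_; Σ; ∃; ∃-syntax; proj₁; proj₂)
open import Data.Integer using (+_)
open import Data.Rational using (ℚ; _+_; _*_; _-_; _/_; 0ℚ; 1ℚ; _≤_; _<_; ∣_∣; ½)
open import Relation.Nullary.Decidable using (⌊_⌋)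
open import Relation.Binary.PropositionalEquality using (_≡_)

-- Generic finite simple graphs: vertex type V, a complete duplicate-free
-- enumeration of V, Boolean equality, Boolean adjacency.

record FinGraph : Set₁ where
  field
    V     : Set
    elems : List V
    _==_  : V → V → Bool
    adj   : V → V → Bool

-- 1 / n as a rational (0 for n = 0; never used with n = 0 below)
invℕ : ℕ → ℚ
invℕ zero    = 0ℚ
invℕ (suc n) = + 1 / suc n

ℕtoℚ : ℕ → ℚ
ℕtoℚ n = + n / 1

sumℚ : List ℚ → ℚ
sumℚ = foldr _+_ 0ℚ

module GraphNotions (G : FinGraph) where
  open FinGraph G

  Σv : (V → ℚ) → ℚ
  Σv f = sumℚ (map f elems)

  deg : V → ℕ
  deg x = length (filter (λ v → T? (adj x v)) elems)
    where
      open import Relation.Nullary using (yes; no)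
      T? : (b : Bool) → Relation.Nullary.Dec (T b)
      T? true  = yes Data.Unit.tt where import Data.Unit
      T? false = no (λ ())

  reach : ℕ → V → V → Bool
  reach zero    x y = x == y
  reach (suc k) x y = reach k x y ∨ any (λ z → adj x z ∧ reach k z y) elems

  private
    search : ℕ → ℕ → V → V → ℕ
    search k₀ zero       x y = k₀
    search k₀ (suc fuel) x y = if reach k₀ x y then k₀ else search (suc k₀) fuel x y

  -- graph distance d(x,y): least length of a walk from x to y
  -- (for a connected graph on |V| vertices this is < |V|, so the search is exhaustive)
  dist : V → V → ℕ
  dist x y = search 0 (length elems) x y

  μ : ℚ → V → V → ℚ
  μ α x v = if x == v then α
            else if adj x v then (1ℚ - α) * invℕ (deg x) else 0ℚ

  IsCoupling : (V → ℚ) → (V → ℚ) → (V → V → ℚ) → Set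
  IsCoupling m n π =
    ((x y : V) → 0ℚ ≤ π x y) ×
    ((x : V) → Σv (λ y → π x y) ≡ m x) ×
    ((y : V) → Σv (λ x → π x y) ≡ n y)

  cost : (V → V → ℚ) → ℚ
  cost π = Σv (λ x → Σv (λ y → ℕtoℚ (dist x y) * π x y))

  IsW₁ : (V → ℚ) → (V → ℚ) → ℚ → Set
  IsW₁ m n w =
    (∃[ π ] (IsCoupling m n π × cost π ≡ w)) ×
    (∀ π → IsCoupling m n π → w ≤ cost π)

  IsKappaα : ℚ → V → V → ℚ → Set
  IsKappaα α x y k =
    ∃[ w ] (IsW₁ (μ α x) (μ α y) w × k ≡ 1ℚ - w * invℕ (dist x y))

  -- κ(x,y) = lim_{α→1} κ_α(x,y)/(1-α) equals c:
  -- ∀ ε>0 ∃ δ>0 ∀ α ∈ [0,1) with 1-δ < α,  |κ_α(x,y)/(1-α) - c| < ε,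
  -- written multiplied through by (1-α) > 0.
  RicciIs : V → V → ℚ → Set
  RicciIs x y c =
    ∀ (ε : ℚ) → 0ℚ < ε →
    ∃[ δ ] (0ℚ < δ ×
      (∀ (α : ℚ) → 0ℚ ≤ α → 1ℚ - δ < α → α < 1ℚ →
        ∃[ k ] (IsKappaα α x y k ×
                ∣ k - c * (1ℚ - α) ∣ < ε * (1ℚ - α))))

record FinGroup : Set₁ where
  field
    G     : Set
    elems : List G
    _==_  : G → G → Bool
    _·_   : G → G → G

CayleyGraph : (𝒢 : FinGroup) → List (FinGroup.G 𝒢) → FinGraph
CayleyGraph 𝒢 S = record
  { V = G ; elems = elems ; _==_ = _==_
  ; adj = λ g h → any (λ s → (g · s) == h) S }
  where open FinGroup 𝒢

-- The quaternion group Q₈ in normal form σ^a τ^b (a ∈ Z/4, b ∈ Z/2),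
-- using the relations σ⁴ = e, τ² = σ², τσ = σ⁻¹τ (equivalent to τ⁻¹στ = σ⁻¹).

Q8 : Set
Q8 = Fin 4 × Fin 2

_⊕4_ : ℕ → ℕ → Fin 4
a ⊕4 c = (a ℕ.+ c) mod 4

_·Q_ : Q8 → Q8 → Q8
(a , Fin.zero)     ·Q (c , d)                = ((toℕ a) ⊕4 (toℕ c) , d)
(a , Fin.suc _)    ·Q (c , Fin.zero)         = ((toℕ a) ⊕4 (3 ℕ.* toℕ c) , Fin.suc Fin.zero)
(a , Fin.suc _)    ·Q (c , Fin.suc _)        = ((toℕ a ℕ.+ 2) ⊕4 (3 ℕ.* toℕ c) , Fin.zero)

_==Q_ : Q8 → Q8 → Bool
(a , b) ==Q (c , d) = ⌊ a ≟F c ⌋ ∧ ⌊ b ≟F d ⌋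

Q8-elems : List Q8
Q8-elems = concatMap (λ b → map (λ a → (a , b)) (Data.List.allFin 4)) (Data.List.allFin 2)
  where import Data.List

Q8-group : FinGroup
Q8-group = record { G = Q8 ; elems = Q8-elems ; _==_ = _==Q_ ; _·_ = _·Q_ }

eQ σ σ⁻¹ τ τ⁻¹ : Q8
eQ  = (Fin.zero , Fin.zero)
σ   = (Fin.suc Fin.zero , Fin.zero)
σ⁻¹ = (Fin.suc (Fin.suc (Fin.suc Fin.zero)) , Fin.zero)
τ   = (Fin.zero , Fin.suc Fin.zero)
τ⁻¹ = (Fin.suc (Fin.suc Fin.zero) , Fin.suc Fin.zero)

open import Relation.Binary.PropositionalEquality using (refl)
private
  σ⁴≡e : σ ·Q (σ ·Q (σ ·Q σ)) ≡ eQ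
  σ⁴≡e = refl
  τ²≡σ² : τ ·Q τ ≡ σ ·Q σ
  τ²≡σ² = refl
  conj : τ⁻¹ ·Q (σ ·Q τ) ≡ σ⁻¹
  conj = refl
  σinv : σ ·Q σ⁻¹ ≡ eQ
  σinv = refl
  τinv : τ ·Q τ⁻¹ ≡ eQ
  τinv = refl

S-Q8 : List Q8
S-Q8 = σ ∷ σ⁻¹ ∷ τ ∷ τ⁻¹ ∷ []

ΓQ8 : FinGraph
ΓQ8 = CayleyGraph Q8-group S-Q8

{-# OPTIONS --safe #-}
module Submission where

-- For α ∈ [½, 1] and an edge x ~ y, keep ¼(1 − α) at x and at y, move the remaining
-- α − ¼(1 − α) from x to y, and spread the mass on each neighbour of x other than y
-- uniformly over the neighbours of y other than x. This coupling of μ_x^α and μ_y^α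
-- costs (1 + α)/2, which is also the Kantorovich lower bound given by the 1-Lipschitz
-- indicator of {x} ∪ N(x) ∖ {y}. Hence W₁ = (1 + α)/2 and κ_α = (1 − α)/2 near α = 1,
-- so κ = ½. Every quantity involved is affine in α, so the finitely many identities
-- and inequalities on the eight vertices are decided on affine forms, nonnegativity
-- of an affine form on [½, 1] being decided at the two endpoints.

open import Defs
open import Data.Bool using (T; _∧_; _∨_; not; if_then_else_; true; false)
open import Data.Nat as ℕ using (ℕ)
open import Data.Fin.Properties using (all?)
open import Data.List using (List; []; _∷_; map; foldr)
open import Data.List.Properties using (map-cong)
open import Data.Product using (_×_; _,_; curry; uncurry)
open import Data.Product.Properties using (≡-dec)
import Data.Integer as ℤ
open import Data.Rational
  using (ℚ; 0ℚ; 1ℚ; ½; _/_; _+_; _*_; _-_; -_; _≤_; _<_; ∣_∣; positive; nonNegative)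
open import Data.Rational.Properties
  using (_≟_; _≤?_; _<?_; +-*-commutativeRing; ≤-refl; <⇒≤; +-mono-≤; +-monoˡ-≤; +-monoˡ-<;
         +-identityˡ; +-inverseʳ; *-comm; *-zeroʳ; *-monoʳ-≤-nonNeg; *-cancelˡ-≤-pos;
         nonNeg*nonNeg⇒nonNeg; pos*pos⇒pos; positive⁻¹; nonNegative⁻¹; module ≤-Reasoning)
open import Level using (0ℓ)
open import Relation.Binary.Definitions using (DecidableEquality)
open import Relation.Binary.PropositionalEquality
  using (_≡_; refl; sym; trans; cong; cong₂; subst; module ≡-Reasoning)
open import Relation.Nullary.Decidable using (Dec; True; toWitness; map′; _→-dec_; T?; dec⇒maybe)
open import Relation.Unary using (Decidable)
open import Tactic.RingSolver using (solve-∀)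
import Tactic.RingSolver.Core.AlmostCommutativeRing as ACR

ℚ-ring : ACR.AlmostCommutativeRing 0ℓ 0ℓ
ℚ-ring = ACR.fromCommutativeRing +-*-commutativeRing (λ q → dec⇒maybe (0ℚ ≟ q))

p≤q⇒0≤q-p : ∀ {p q} → p ≤ q → 0ℚ ≤ q - p
p≤q⇒0≤q-p {p} {q} p≤q = subst (_≤ q - p) (+-inverseʳ p) (+-monoˡ-≤ (- p) p≤q)

p<q⇒0<q-p : ∀ {p q} → p < q → 0ℚ < q - p
p<q⇒0<q-p {p} {q} p<q = subst (_< q - p) (+-inverseʳ p) (+-monoˡ-< (- p) p<q)

0≤p*q : ∀ {p q} → 0ℚ ≤ p → 0ℚ ≤ q → 0ℚ ≤ p * q
0≤p*q {p} {q} 0≤p 0≤q =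
  nonNegative⁻¹ (p * q) {{nonNeg*nonNeg⇒nonNeg p {{nonNegative 0≤p}} q {{nonNegative 0≤q}}}}

∑ : {A : Set} → List A → (A → ℚ) → ℚ
∑ xs f = sumℚ (map f xs)

module _ {A : Set} where

  ∑-cong : ∀ xs {f g : A → ℚ} → (∀ a → f a ≡ g a) → ∑ xs f ≡ ∑ xs g
  ∑-cong xs f≗g = cong sumℚ (map-cong f≗g xs)

  ∑-0 : ∀ (xs : List A) → ∑ xs (λ _ → 0ℚ) ≡ 0ℚ
  ∑-0 []       = refl
  ∑-0 (_ ∷ xs) = cong (0ℚ +_) (∑-0 xs)

  ∑-+ : ∀ xs (f g : A → ℚ) → ∑ xs (λ a → f a + g a) ≡ ∑ xs f + ∑ xs g
  ∑-+ []       f g = refl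
  ∑-+ (a ∷ xs) f g = trans (cong (f a + g a +_) (∑-+ xs f g)) (exchange (f a) (g a) _ _)
    where exchange : ∀ p q r s → p + q + (r + s) ≡ p + r + (q + s)
          exchange = solve-∀ ℚ-ring

  ∑-- : ∀ xs (f g : A → ℚ) → ∑ xs (λ a → f a - g a) ≡ ∑ xs f - ∑ xs g
  ∑-- []       f g = refl
  ∑-- (a ∷ xs) f g = trans (cong (f a - g a +_) (∑-- xs f g)) (exchange (f a) (g a) _ _)
    where exchange : ∀ p q r s → p - q + (r - s) ≡ p + r - (q + s)
          exchange = solve-∀ ℚ-ring

  ∑-*ˡ : ∀ xs c (f : A → ℚ) → ∑ xs (λ a → c * f a) ≡ c * ∑ xs f
  ∑-*ˡ []       c f = sym (*-zeroʳ c)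
  ∑-*ˡ (a ∷ xs) c f = trans (cong (c * f a +_) (∑-*ˡ xs c f)) (distrib c (f a) _)
    where distrib : ∀ p q r → p * q + p * r ≡ p * (q + r)
          distrib = solve-∀ ℚ-ring

  ∑-mono-≤ : ∀ xs {f g : A → ℚ} → (∀ a → f a ≤ g a) → ∑ xs f ≤ ∑ xs g
  ∑-mono-≤ []       f≤g = ≤-refl
  ∑-mono-≤ (a ∷ xs) f≤g = +-mono-≤ (f≤g a) (∑-mono-≤ xs f≤g)

∑-comm : ∀ {A B : Set} xs ys (h : A → B → ℚ) →
         ∑ xs (λ a → ∑ ys (h a)) ≡ ∑ ys (λ b → ∑ xs (λ a → h a b))
∑-comm []       ys h = sym (∑-0 ys)
∑-comm (a ∷ xs) ys h =
  trans (cong (∑ ys (h a) +_) (∑-comm xs ys h)) (sym (∑-+ ys (h a) (λ b → ∑ xs (λ a′ → h a′ b))))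

Affine : Set
Affine = ℚ × ℚ

⟦_⟧ : Affine → ℚ → ℚ
⟦ a , b ⟧ α = a * α + b

_≟ᵃ_ : DecidableEquality Affine
_≟ᵃ_ = ≡-dec _≟_ _≟_

0ᵃ αᵃ 1-αᵃ : Affine
0ᵃ   = 0ℚ , 0ℚ
αᵃ   = 1ℚ , 0ℚ
1-αᵃ = - 1ℚ , 1ℚ

infixl 6 _+ᵃ_ _-ᵃ_
infixr 7 _·ᵃ_

_+ᵃ_ _-ᵃ_ : Affine → Affine → Affine
(a , b) +ᵃ (c , d) = a + c , b + d
(a , b) -ᵃ (c , d) = a - c , b - d

_·ᵃ_ : ℚ → Affine → Affine
c ·ᵃ (a , b) = c * a , c * b

∑ᵃ : {A : Set} → List A → (A → Affine) → Affine
∑ᵃ xs p = foldr _+ᵃ_ 0ᵃ (map p xs)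

∑ᵃ-cong : ∀ {A : Set} xs {p q : A → Affine} → (∀ a → p a ≡ q a) → ∑ᵃ xs p ≡ ∑ᵃ xs q
∑ᵃ-cong xs p≗q = cong (foldr _+ᵃ_ 0ᵃ) (map-cong p≗q xs)

⟦0ᵃ⟧ : ∀ α → ⟦ 0ᵃ ⟧ α ≡ 0ℚ
⟦0ᵃ⟧ α = lemma α
  where lemma : ∀ α → 0ℚ * α + 0ℚ ≡ 0ℚ
        lemma = solve-∀ ℚ-ring

⟦αᵃ⟧ : ∀ α → ⟦ αᵃ ⟧ α ≡ α
⟦αᵃ⟧ α = lemma α
  where lemma : ∀ α → 1ℚ * α + 0ℚ ≡ α
        lemma = solve-∀ ℚ-ring

⟦1-αᵃ⟧ : ∀ α → ⟦ 1-αᵃ ⟧ α ≡ 1ℚ - α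
⟦1-αᵃ⟧ α = lemma α
  where lemma : ∀ α → - 1ℚ * α + 1ℚ ≡ 1ℚ - α
        lemma = solve-∀ ℚ-ring

⟦-ᵃ⟧ : ∀ p q α → ⟦ p -ᵃ q ⟧ α ≡ ⟦ p ⟧ α - ⟦ q ⟧ α
⟦-ᵃ⟧ (a , b) (c , d) α = lemma a b c d α
  where lemma : ∀ a b c d α → (a - c) * α + (b - d) ≡ a * α + b - (c * α + d)
        lemma = solve-∀ ℚ-ring

⟦·ᵃ⟧ : ∀ c p α → ⟦ c ·ᵃ p ⟧ α ≡ c * ⟦ p ⟧ α
⟦·ᵃ⟧ c (a , b) α = lemma c a b α
  where lemma : ∀ c a b α → c * a * α + c * b ≡ c * (a * α + b)
        lemma = solve-∀ ℚ-ring

⟦∑ᵃ⟧ : ∀ {A : Set} xs (p : A → Affine) α → ⟦ ∑ᵃ xs p ⟧ α ≡ ∑ xs (λ a → ⟦ p a ⟧ α)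
⟦∑ᵃ⟧ []       p α = ⟦0ᵃ⟧ α
⟦∑ᵃ⟧ (a ∷ xs) p α = trans (⟦+ᵃ⟧ (p a) (∑ᵃ xs p)) (cong (⟦ p a ⟧ α +_) (⟦∑ᵃ⟧ xs p α))
  where ⟦+ᵃ⟧ : ∀ q r → ⟦ q +ᵃ r ⟧ α ≡ ⟦ q ⟧ α + ⟦ r ⟧ α
        ⟦+ᵃ⟧ (a , b) (c , d) = lemma a b c d α
          where lemma : ∀ a b c d α → (a + c) * α + (b + d) ≡ a * α + b + (c * α + d)
                lemma = solve-∀ ℚ-ring

-- An affine function is a convex combination of its values at the endpoints.
⟦⟧-nonneg-between : ∀ p {a b α} → a < b → a ≤ α → α ≤ b →
                    0ℚ ≤ ⟦ p ⟧ a → 0ℚ ≤ ⟦ p ⟧ b → 0ℚ ≤ ⟦ p ⟧ α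
⟦⟧-nonneg-between p {a} {b} {α} a<b a≤α α≤b pa≥0 pb≥0 =
  *-cancelˡ-≤-pos (b - a) {{positive (p<q⇒0<q-p a<b)}} (begin
    (b - a) * 0ℚ                              ≡⟨ *-zeroʳ (b - a) ⟩
    0ℚ                                        ≤⟨ +-mono-≤ (0≤p*q (p≤q⇒0≤q-p a≤α) pb≥0)
                                                            (0≤p*q (p≤q⇒0≤q-p α≤b) pa≥0) ⟩
    (α - a) * ⟦ p ⟧ b + (b - α) * ⟦ p ⟧ a      ≡⟨ interpolation p ⟩
    (b - a) * ⟦ p ⟧ α                          ∎)
  where
    open ≤-Reasoning
    interpolation : ∀ p → (α - a) * ⟦ p ⟧ b + (b - α) * ⟦ p ⟧ a ≡ (b - a) * ⟦ p ⟧ α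
    interpolation (s , t) = lemma s t a b α
      where lemma : ∀ s t a b α →
                    (α - a) * (s * b + t) + (b - α) * (s * a + t) ≡ (b - a) * (s * α + t)
            lemma = solve-∀ ℚ-ring

module _ (G : FinGraph) where
  open FinGraph G
  open GraphNotions G

  1-Lipschitz : (V → ℚ) → Set
  1-Lipschitz f = ∀ u v → f u - f v ≤ ℕtoℚ (dist u v)

  kantorovich : (V → ℚ) → (V → ℚ) → (V → ℚ) → ℚ
  kantorovich f m n = Σv (λ u → f u * m u) - Σv (λ v → f v * n v)

  kantorovich≤cost : ∀ {f m n π} → 1-Lipschitz f → IsCoupling m n π → kantorovich f m n ≤ cost π
  kantorovich≤cost {f} {m} {n} {π} f-lip (π≥0 , rows , cols) = begin
    Σv (λ u → f u * m u) - Σv (λ v → f v * n v)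
      ≡⟨ cong₂ _-_ (∑-cong elems (λ u → cong (f u *_) (sym (rows u))))
                   (∑-cong elems (λ v → cong (f v *_) (sym (cols v)))) ⟩
    Σv (λ u → f u * Σv (π u)) - Σv (λ v → f v * Σv (λ u → π u v))
      ≡⟨ cong₂ _-_ (∑-cong elems (λ u → sym (∑-*ˡ elems (f u) (π u))))
                   (trans (∑-cong elems (λ v → sym (∑-*ˡ elems (f v) (λ u → π u v))))
                          (sym (∑-comm elems elems (λ u v → f v * π u v)))) ⟩
    Σv (λ u → Σv (λ v → f u * π u v)) - Σv (λ u → Σv (λ v → f v * π u v))
      ≡⟨ sym (trans (∑-cong elems (λ u → ∑-- elems (λ v → f u * π u v) (λ v → f v * π u v)))
                    (∑-- elems _ _)) ⟩
    Σv (λ u → Σv (λ v → f u * π u v - f v * π u v))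
      ≤⟨ ∑-mono-≤ elems (λ u → ∑-mono-≤ elems (λ v → transport-bound u v)) ⟩
    cost π ∎
    where
      open ≤-Reasoning
      transport-bound : ∀ u v → f u * π u v - f v * π u v ≤ ℕtoℚ (dist u v) * π u v
      transport-bound u v = subst (_≤ _) (distrib (f u) (f v) (π u v))
        (*-monoʳ-≤-nonNeg (π u v) {{nonNegative (π≥0 u v)}} (f-lip u v))
        where distrib : ∀ p q r → (p - q) * r ≡ p * r - q * r
              distrib = solve-∀ ℚ-ring

  cost≡kantorovich⇒IsW₁ : ∀ {f m n π} → IsCoupling m n π → 1-Lipschitz f →
                          cost π ≡ kantorovich f m n → IsW₁ m n (cost π)
  cost≡kantorovich⇒IsW₁ {f} {π = π} π-coupling f-lip tight =
    (π , π-coupling , refl) ,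
    λ π′ π′-coupling → subst (_≤ cost π′) (sym tight) (kantorovich≤cost {f} f-lip π′-coupling)

  μᵃ : V → V → Affine
  μᵃ x v = if x == v then αᵃ else if adj x v then invℕ (deg x) ·ᵃ 1-αᵃ else 0ᵃ

  ⟦μᵃ⟧ : ∀ α x v → ⟦ μᵃ x v ⟧ α ≡ μ α x v
  ⟦μᵃ⟧ α x v = cases (x == v) (adj x v)
    where
      c = invℕ (deg x)
      cases : ∀ b b′ → ⟦ if b then αᵃ else if b′ then c ·ᵃ 1-αᵃ else 0ᵃ ⟧ α
                       ≡ (if b then α else if b′ then (1ℚ - α) * c else 0ℚ)
      cases true  _     = ⟦αᵃ⟧ α
      cases false true  = trans (⟦·ᵃ⟧ c 1-αᵃ α) (trans (cong (c *_) (⟦1-αᵃ⟧ α)) (*-comm c (1ℚ - α)))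
      cases false false = ⟦0ᵃ⟧ α

  costᵃ : (V → V → ℕ) → (V → V → Affine) → Affine
  costᵃ d P = ∑ᵃ elems (λ u → ∑ᵃ elems (λ v → ℕtoℚ (d u v) ·ᵃ P u v))

  costᵃ-cong : ∀ {d d′} P → (∀ u v → d u v ≡ d′ u v) → costᵃ d P ≡ costᵃ d′ P
  costᵃ-cong P d≗d′ = ∑ᵃ-cong elems λ u → ∑ᵃ-cong elems λ v → cong (λ n → ℕtoℚ n ·ᵃ P u v) (d≗d′ u v)

  kantorovichᵃ : (V → ℚ) → V → V → Affine
  kantorovichᵃ f x y = ∑ᵃ elems (λ u → f u ·ᵃ μᵃ x u) -ᵃ ∑ᵃ elems (λ v → f v ·ᵃ μᵃ y v)

  ⟦costᵃ⟧ : ∀ P α → ⟦ costᵃ dist P ⟧ α ≡ cost (λ u v → ⟦ P u v ⟧ α)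
  ⟦costᵃ⟧ P α = trans (⟦∑ᵃ⟧ elems _ α) (∑-cong elems λ u →
                  trans (⟦∑ᵃ⟧ elems _ α) (∑-cong elems λ v → ⟦·ᵃ⟧ (ℕtoℚ (dist u v)) (P u v) α))

  ⟦kantorovichᵃ⟧ : ∀ f x y α → ⟦ kantorovichᵃ f x y ⟧ α ≡ kantorovich f (μ α x) (μ α y)
  ⟦kantorovichᵃ⟧ f x y α =
    trans (⟦-ᵃ⟧ (∑ᵃ elems (λ u → f u ·ᵃ μᵃ x u)) (∑ᵃ elems (λ v → f v ·ᵃ μᵃ y v)) α)
          (cong₂ _-_ (⟦f·μᵃ⟧ x) (⟦f·μᵃ⟧ y))
    where
      ⟦f·μᵃ⟧ : ∀ z → ⟦ ∑ᵃ elems (λ u → f u ·ᵃ μᵃ z u) ⟧ α ≡ Σv (λ u → f u * μ α z u)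
      ⟦f·μᵃ⟧ z = trans (⟦∑ᵃ⟧ elems _ α) (∑-cong elems λ u →
                   trans (⟦·ᵃ⟧ (f u) (μᵃ z u) α) (cong (f u *_) (⟦μᵃ⟧ α z u)))

  record IsTransportCertificate (α₀ : ℚ) (x y : V) (plan : V → V → Affine) (potential : V → ℚ)
         : Set where
    field
      plan-rows        : ∀ u → ∑ᵃ elems (plan u) ≡ μᵃ x u
      plan-cols        : ∀ v → ∑ᵃ elems (λ u → plan u v) ≡ μᵃ y v
      plan-nonneg-α₀   : ∀ u v → 0ℚ ≤ ⟦ plan u v ⟧ α₀
      plan-nonneg-1    : ∀ u v → 0ℚ ≤ ⟦ plan u v ⟧ 1ℚ
      potential-lip    : 1-Lipschitz potential
      cost≡kantorovich : costᵃ dist plan ≡ kantorovichᵃ potential x y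

  module _ {α₀ x y plan potential} (C : IsTransportCertificate α₀ x y plan potential) where
    open IsTransportCertificate C

    certificate⇒IsW₁ : ∀ {α} → α₀ < 1ℚ → α₀ ≤ α → α ≤ 1ℚ →
                       IsW₁ (μ α x) (μ α y) (⟦ costᵃ dist plan ⟧ α)
    certificate⇒IsW₁ {α} α₀<1 α₀≤α α≤1 =
      subst (IsW₁ (μ α x) (μ α y)) (sym (⟦costᵃ⟧ plan α))
        (cost≡kantorovich⇒IsW₁ {potential} π-coupling potential-lip tight)
      where
        π : V → V → ℚ
        π u v = ⟦ plan u v ⟧ α

        π-coupling : IsCoupling (μ α x) (μ α y) π
        π-coupling =
          (λ u v → ⟦⟧-nonneg-between (plan u v) α₀<1 α₀≤α α≤1 (plan-nonneg-α₀ u v) (plan-nonneg-1 u v)) ,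
          (λ u → trans (sym (⟦∑ᵃ⟧ elems (plan u) α))
                       (trans (cong (λ p → ⟦ p ⟧ α) (plan-rows u)) (⟦μᵃ⟧ α x u))) ,
          (λ v → trans (sym (⟦∑ᵃ⟧ elems (λ u → plan u v) α))
                       (trans (cong (λ p → ⟦ p ⟧ α) (plan-cols v)) (⟦μᵃ⟧ α y v)))

        tight : cost π ≡ kantorovich potential (μ α x) (μ α y)
        tight = trans (sym (⟦costᵃ⟧ plan α))
                      (trans (cong (λ p → ⟦ p ⟧ α) cost≡kantorovich) (⟦kantorovichᵃ⟧ potential x y α))

    certificate⇒IsKappaα : ∀ {α} → α₀ < 1ℚ → α₀ ≤ α → α ≤ 1ℚ →
                           IsKappaα α x y (1ℚ - ⟦ costᵃ dist plan ⟧ α * invℕ (dist x y))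
    certificate⇒IsKappaα α₀<1 α₀≤α α≤1 = _ , certificate⇒IsW₁ α₀<1 α₀≤α α≤1 , refl

  ricci-of-exact-κ : ∀ x y c {α₀} → α₀ < 1ℚ →
                     (∀ α → α₀ < α → α < 1ℚ → IsKappaα α x y (c * (1ℚ - α))) → RicciIs x y c
  ricci-of-exact-κ x y c {α₀} α₀<1 κ-exact ε ε>0 =
    1ℚ - α₀ , p<q⇒0<q-p α₀<1 , λ α _ 1-δ<α α<1 →
      c * (1ℚ - α) ,
      κ-exact α (subst (_< α) (1-[1-p]≡p α₀) 1-δ<α) α<1 ,
      subst (λ t → ∣ t ∣ < ε * (1ℚ - α)) (sym (+-inverseʳ (c * (1ℚ - α))))
        (positive⁻¹ (ε * (1ℚ - α))
          {{pos*pos⇒pos ε {{positive ε>0}} (1ℚ - α) {{positive (p<q⇒0<q-p α<1)}}}})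
    where
      1-[1-p]≡p : ∀ p → 1ℚ - (1ℚ - p) ≡ p
      1-[1-p]≡p = solve-∀ ℚ-ring

open FinGraph ΓQ8 using (elems; adj; _==_)
open GraphNotions ΓQ8

decide : ∀ {A : Set} (a? : Dec A) → {True a?} → A
decide _ {a} = toWitness a

Q8-∀? : ∀ {P : Q8 → Set} → Decidable P → Dec (∀ u → P u)
Q8-∀? P? = map′ uncurry curry (all? λ a → all? λ b → P? (a , b))

Q8-edges? : ∀ {P : Q8 → Q8 → Set} → (∀ x y → Dec (P x y)) → Dec (∀ x y → T (adj x y) → P x y)
Q8-edges? P? = Q8-∀? λ x → Q8-∀? λ y → T? (adj x y) →-dec P? x y

-- `dist` is computed by a search too slow to run inside the per-edge decisions below,
-- so those are decided against this table.
Q8-dist : Q8 → Q8 → ℕ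
Q8-dist u v = if u == v then 0 else if adj u v then 1 else 2

dist≡Q8-dist : ∀ u v → dist u v ≡ Q8-dist u v
dist≡Q8-dist = decide (Q8-∀? λ u → Q8-∀? λ v → dist u v ℕ.≟ Q8-dist u v)

Q8-edge-dist : ∀ x y → T (adj x y) → dist x y ≡ 1
Q8-edge-dist = decide (Q8-edges? λ x y → dist x y ℕ.≟ 1)

¼ 1/12 : ℚ
¼    = ℤ.+ 1 / 4
1/12 = ℤ.+ 1 / 12

Q8-plan : Q8 → Q8 → Q8 → Q8 → Affine
Q8-plan x y u v =
  if x == u then (if x == v then ¼ ·ᵃ 1-αᵃ else if y == v then αᵃ -ᵃ ¼ ·ᵃ 1-αᵃ else 0ᵃ)
  else if y == u then (if y == v then ¼ ·ᵃ 1-αᵃ else 0ᵃ)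
  else if adj x u ∧ adj y v ∧ not (x == v) then 1/12 ·ᵃ 1-αᵃ else 0ᵃ

Q8-potential : Q8 → Q8 → Q8 → ℚ
Q8-potential x y u = if x == u ∨ (adj x u ∧ not (y == u)) then 1ℚ else 0ℚ

Q8-plan-cost : ∀ x y → T (adj x y) → costᵃ ΓQ8 dist (Q8-plan x y) ≡ (½ , ½)
Q8-plan-cost x y x~y = trans (costᵃ-cong ΓQ8 (Q8-plan x y) dist≡Q8-dist)
  (decide (Q8-edges? λ x y → costᵃ ΓQ8 Q8-dist (Q8-plan x y) ≟ᵃ (½ , ½)) x y x~y)

Q8-potential-kantorovich : ∀ x y → T (adj x y) → kantorovichᵃ ΓQ8 (Q8-potential x y) x y ≡ (½ , ½)
Q8-potential-kantorovich =
  decide (Q8-edges? λ x y → kantorovichᵃ ΓQ8 (Q8-potential x y) x y ≟ᵃ (½ , ½))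

Q8-plan-rows : ∀ x y → T (adj x y) → ∀ u → ∑ᵃ elems (Q8-plan x y u) ≡ μᵃ ΓQ8 x u
Q8-plan-rows = decide (Q8-edges? λ x y → Q8-∀? λ u → ∑ᵃ elems (Q8-plan x y u) ≟ᵃ μᵃ ΓQ8 x u)

Q8-plan-cols : ∀ x y → T (adj x y) → ∀ v → ∑ᵃ elems (λ u → Q8-plan x y u v) ≡ μᵃ ΓQ8 y v
Q8-plan-cols =
  decide (Q8-edges? λ x y → Q8-∀? λ v → ∑ᵃ elems (λ u → Q8-plan x y u v) ≟ᵃ μᵃ ΓQ8 y v)

Q8-plan-nonneg-½ : ∀ x y → T (adj x y) → ∀ u v → 0ℚ ≤ ⟦ Q8-plan x y u v ⟧ ½
Q8-plan-nonneg-½ =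
  decide (Q8-edges? λ x y → Q8-∀? λ u → Q8-∀? λ v → 0ℚ ≤? ⟦ Q8-plan x y u v ⟧ ½)

Q8-plan-nonneg-1 : ∀ x y → T (adj x y) → ∀ u v → 0ℚ ≤ ⟦ Q8-plan x y u v ⟧ 1ℚ
Q8-plan-nonneg-1 =
  decide (Q8-edges? λ x y → Q8-∀? λ u → Q8-∀? λ v → 0ℚ ≤? ⟦ Q8-plan x y u v ⟧ 1ℚ)

Q8-potential-lip : ∀ x y → T (adj x y) → 1-Lipschitz ΓQ8 (Q8-potential x y)
Q8-potential-lip x y x~y u v =
  subst (λ d → Q8-potential x y u - Q8-potential x y v ≤ ℕtoℚ d) (sym (dist≡Q8-dist u v))
    (decide (Q8-edges? λ x y → Q8-∀? λ u → Q8-∀? λ v →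
               Q8-potential x y u - Q8-potential x y v ≤? ℕtoℚ (Q8-dist u v)) x y x~y u v)

Q8-certificate : ∀ x y → T (adj x y) →
                 IsTransportCertificate ΓQ8 ½ x y (Q8-plan x y) (Q8-potential x y)
Q8-certificate x y x~y = record
  { plan-rows        = Q8-plan-rows x y x~y
  ; plan-cols        = Q8-plan-cols x y x~y
  ; plan-nonneg-α₀   = Q8-plan-nonneg-½ x y x~y
  ; plan-nonneg-1    = Q8-plan-nonneg-1 x y x~y
  ; potential-lip    = Q8-potential-lip x y x~y
  ; cost≡kantorovich = trans (Q8-plan-cost x y x~y) (sym (Q8-potential-kantorovich x y x~y))
  }

½<1 : ½ < 1ℚ
½<1 = decide (½ <? 1ℚ)

Q8-κα : ∀ x y → T (adj x y) → ∀ α →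
        1ℚ - ⟦ costᵃ ΓQ8 dist (Q8-plan x y) ⟧ α * invℕ (dist x y) ≡ ½ * (1ℚ - α)
Q8-κα x y x~y α = begin
  1ℚ - ⟦ costᵃ ΓQ8 dist (Q8-plan x y) ⟧ α * invℕ (dist x y)
    ≡⟨ cong₂ (λ p d → 1ℚ - ⟦ p ⟧ α * invℕ d) (Q8-plan-cost x y x~y) (Q8-edge-dist x y x~y) ⟩
  1ℚ - (½ * α + ½) * 1ℚ
    ≡⟨ regroup ½ α ⟩
  1ℚ - (½ + ½) + ½ * (1ℚ - α)
    ≡⟨ +-identityˡ (½ * (1ℚ - α)) ⟩
  ½ * (1ℚ - α) ∎
  where
    open ≡-Reasoning
    regroup : ∀ h α → 1ℚ - (h * α + h) * 1ℚ ≡ 1ℚ - (h + h) + h * (1ℚ - α)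
    regroup = solve-∀ ℚ-ring

proposition5 : ∀ (x y : Q8) → T (FinGraph.adj ΓQ8 x y) → GraphNotions.RicciIs ΓQ8 x y ½
proposition5 x y x~y = ricci-of-exact-κ ΓQ8 x y ½ ½<1 λ α ½<α α<1 →
  subst (IsKappaα α x y) (Q8-κα x y x~y α)
    (certificate⇒IsKappaα ΓQ8 (Q8-certificate x y x~y) ½<1 (<⇒≤ ½<α) (<⇒≤ α<1))
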